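{- Let $\boldsymbol u$ be a faux-bonacci $\omega$-word and, for $n\ge2$, let $w_n=y_nF_n$ be the shortest prefix of $\boldsymbol u$ ending in $F_n$. Then for every $n\ge2$, $\pi(y_n)\le\pi(F_n)-\pi(0)$.
   Context: The finite Fibonacci words are $F_0=0$, $F_1=01$, $F_{n+2}=F_{n+1}F_n$. For a binary word $w$, $\pi(w)=[|w|_0,|w|_1]$ is its Parikh vector (numbers of 0s and 1s), and vectors are compared componentwise. For non-empty $X$, $X^-$ is $X$ with its last letter erased; a $4^-$-power is $XXXX^-$ with $X$ non-empty; a binary word is faux-bonacci if it has no factor $11$ and no factor that is a $4^-$-power. -}

module Defs where

open import Data.Nat using (ℕ; zero; suc; _+_; _∸_; _≤_; _<_)
open import Data.List using (List; []; _∷_; _++_; length)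
open import Data.Product using (_×_; ∃)
open import Relation.Binary.PropositionalEquality using (_≡_; _≢_)
open import Relation.Nullary using (¬_)

data Letter : Set where
  𝟎 𝟏 : Letter

Word : Set
Word = List Letter

ωWord : Set
ωWord = ℕ → Letter

F : ℕ → Word
F zero = 𝟎 ∷ []
F (suc zero) = 𝟎 ∷ 𝟏 ∷ []
F (suc (suc n)) = F (suc n) ++ F n

count : Letter → Word → ℕ
count a [] = 0
count 𝟎 (𝟎 ∷ w) = suc (count 𝟎 w)
count 𝟎 (𝟏 ∷ w) = count 𝟎 w
count 𝟏 (𝟎 ∷ w) = count 𝟏 w
count 𝟏 (𝟏 ∷ w) = suc (count 𝟏 w)

record Parikh : Set where
  constructor ⟨_,_⟩
  field
    zeros : ℕ
    ones  : ℕ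

π : Word → Parikh
π w = ⟨ count 𝟎 w , count 𝟏 w ⟩

_≤π_ : Parikh → Parikh → Set
⟨ a , b ⟩ ≤π ⟨ c , d ⟩ = (a ≤ c) × (b ≤ d)

_-π_ : Parikh → Parikh → Parikh
⟨ a , b ⟩ -π ⟨ c , d ⟩ = ⟨ a ∸ c , b ∸ d ⟩

_⁻ : Word → Word
[] ⁻ = []
(a ∷ []) ⁻ = []
(a ∷ b ∷ w) ⁻ = a ∷ ((b ∷ w) ⁻)

4⁻-power : Word → Word
4⁻-power X = X ++ X ++ X ++ (X ⁻)

slice : ωWord → ℕ → ℕ → Word
slice u i zero = []
slice u i (suc n) = u i ∷ slice u (suc i) n

prefix : ℕ → ωWord → Word
prefix n u = slice u 0 n

Factorω : Word → ωWord → Set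
Factorω v u = ∃ λ i → slice u i (length v) ≡ v

FauxBonacciω : ωWord → Set
FauxBonacciω u =
  ¬ Factorω (𝟏 ∷ 𝟏 ∷ []) u ×
  (∀ (X : Word) → X ≢ [] → ¬ Factorω (4⁻-power X) u)

EndsIn : Word → Word → Set
EndsIn w v = ∃ λ z → w ≡ z ++ v

ShortestPrefixEndingIn : ωWord → Word → Word → Set
ShortestPrefixEndingIn u y v =
  prefix (length (y ++ v)) u ≡ y ++ v ×
  (∀ m → m < length (y ++ v) → ¬ EndsIn (prefix m u) v)

{-# OPTIONS --safe #-}
module Submission where

-- Write a word without factor 11 as s φ(u′) with φ : 0 ↦ 01, 1 ↦ 0 and s ∈ {ε, 1}. The
-- desubstituted word u′ is again faux-bonacci, since φ turns 11 into 000 and 4⁻-powers into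
-- 4⁻-powers. An occurrence of w in u′ after a prefix with Parikh vector ≤ [a, b] yields an
-- occurrence of φ(w)0 in u after a prefix with Parikh vector ≤ [a + b, a + 1]. Starting from
-- the first 0 of u′ (after a prefix ≤ [0, 1]) and using φ(F n) = F (n + 1), induction gives an
-- occurrence of F n (n ≥ 2) after a prefix ≤ π(F n) − π(0); the shortest prefix ending in F n
-- ends no later, so y is a prefix of that prefix.

open import Defs
open import Data.Nat using (ℕ; zero; suc; _+_; _∸_; _≤_; _<_; z≤n; s≤s; _≤?_)
open import Data.Nat.Properties
  using (≤-trans; m≤m+n; +-mono-≤; +-comm; +-suc; +-identityʳ; +-monoˡ-<; ≰⇒>; m+[n∸m]≡n)
open import Data.List
  using ([]; _∷_; _++_; _∷ʳ_; length; concatMap; _∷ʳ′_; initLast)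
open import Data.List.Properties using (length-++; ++-assoc; ++-identityʳ; ∷-injective; concatMap-++)
open import Data.Product using (_×_; _,_; proj₁; proj₂; ∃)
open import Data.Empty using (⊥-elim)
open import Relation.Nullary using (¬_; yes; no)
open import Relation.Binary.PropositionalEquality

count-++ : ∀ a (v w : Word) → count a (v ++ w) ≡ count a v + count a w
count-++ 𝟎 [] w = refl
count-++ 𝟏 [] w = refl
count-++ 𝟎 (𝟎 ∷ v) w = cong suc (count-++ 𝟎 v w)
count-++ 𝟎 (𝟏 ∷ v) w = count-++ 𝟎 v w
count-++ 𝟏 (𝟎 ∷ v) w = count-++ 𝟏 v w
count-++ 𝟏 (𝟏 ∷ v) w = cong suc (count-++ 𝟏 v w)

_+π_ : Parikh → Parikh → Parikh
⟨ a , b ⟩ +π ⟨ c , d ⟩ = ⟨ a + c , b + d ⟩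

π-++ : ∀ (v w : Word) → π (v ++ w) ≡ π v +π π w
π-++ v w = cong₂ ⟨_,_⟩ (count-++ 𝟎 v w) (count-++ 𝟏 v w)

≤π-trans : ∀ {p q r} → p ≤π q → q ≤π r → p ≤π r
≤π-trans (a , b) (c , d) = ≤-trans a c , ≤-trans b d

≤π-+π : ∀ p q → p ≤π (p +π q)
≤π-+π ⟨ a , b ⟩ ⟨ c , d ⟩ = m≤m+n a c , m≤m+n b d

+π-mono-≤π : ∀ {p p′ q q′} → p ≤π p′ → q ≤π q′ → (p +π q) ≤π (p′ +π q′)
+π-mono-≤π (a , b) (c , d) = +-mono-≤ a c , +-mono-≤ b d

φ : Letter → Word
φ 𝟎 = 𝟎 ∷ 𝟏 ∷ []
φ 𝟏 = 𝟎 ∷ []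

φ* : Word → Word
φ* = concatMap φ

φπ : Parikh → Parikh
φπ ⟨ a , b ⟩ = ⟨ a + b , a ⟩

count𝟎-φ* : ∀ w → count 𝟎 (φ* w) ≡ count 𝟎 w + count 𝟏 w
count𝟎-φ* [] = refl
count𝟎-φ* (𝟎 ∷ w) = cong suc (count𝟎-φ* w)
count𝟎-φ* (𝟏 ∷ w) = trans (cong suc (count𝟎-φ* w)) (sym (+-suc (count 𝟎 w) (count 𝟏 w)))

count𝟏-φ* : ∀ w → count 𝟏 (φ* w) ≡ count 𝟎 w
count𝟏-φ* [] = refl
count𝟏-φ* (𝟎 ∷ w) = cong suc (count𝟏-φ* w)
count𝟏-φ* (𝟏 ∷ w) = count𝟏-φ* w

π-φ* : ∀ w → π (φ* w) ≡ φπ (π w)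
π-φ* w = cong₂ ⟨_,_⟩ (count𝟎-φ* w) (count𝟏-φ* w)

φπ-mono-≤π : ∀ {p q} → p ≤π q → φπ p ≤π φπ q
φπ-mono-≤π (a , b) = +-mono-≤ a b , a

φ*-F : ∀ n → φ* (F n) ≡ F (suc n)
φ*-F zero = refl
φ*-F (suc zero) = refl
φ*-F (suc (suc n)) =
  trans (concatMap-++ φ (F (suc n)) (F n)) (cong₂ _++_ (φ*-F (suc n)) (φ*-F n))

F-head : ∀ n → ∃ λ t → F n ≡ 𝟎 ∷ t
F-head zero = [] , refl
F-head (suc zero) = 𝟏 ∷ [] , refl
F-head (suc (suc n)) with F-head (suc n)
... | t , e = t ++ F n , cong (_++ F n) e

⁻-∷ʳ : ∀ (xs : Word) x → (xs ∷ʳ x) ⁻ ≡ xs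
⁻-∷ʳ [] x = refl
⁻-∷ʳ (a ∷ []) x = refl
⁻-∷ʳ (a ∷ b ∷ xs) x = cong (a ∷_) (⁻-∷ʳ (b ∷ xs) x)

⁻-++ : ∀ (v : Word) {w} → w ≢ [] → (v ++ w) ⁻ ≡ v ++ w ⁻
⁻-++ [] w≢[] = refl
⁻-++ (a ∷ []) {[]} w≢[] = ⊥-elim (w≢[] refl)
⁻-++ (a ∷ []) {b ∷ w} w≢[] = refl
⁻-++ (a ∷ b ∷ v) w≢[] = cong (a ∷_) (⁻-++ (b ∷ v) w≢[])

φ*-≢[] : ∀ w → w ≢ [] → φ* w ≢ []
φ*-≢[] [] w≢[] = w≢[]
φ*-≢[] (𝟎 ∷ w) w≢[] ()
φ*-≢[] (𝟏 ∷ w) w≢[] ()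

φ*-⁻ : ∀ X → X ≢ [] → ∃ λ r → φ* (X ⁻) ++ 𝟎 ∷ [] ≡ (φ* X) ⁻ ++ r
φ*-⁻ X X≢[] with initLast X
... | [] = ⊥-elim (X≢[] refl)
... | xs ∷ʳ′ x
  rewrite ⁻-∷ʳ xs x | concatMap-++ φ xs (x ∷ []) | ⁻-++ (φ* xs) (φ*-≢[] (x ∷ []) λ ())
  with x
... | 𝟎 = [] , sym (++-identityʳ _)
... | 𝟏 = 𝟎 ∷ [] , cong (_++ 𝟎 ∷ []) (sym (++-identityʳ _))

φ*-4⁻-power : ∀ X → X ≢ [] → ∃ λ r → φ* (4⁻-power X) ++ 𝟎 ∷ [] ≡ 4⁻-power (φ* X) ++ r
φ*-4⁻-power X X≢[] with φ*-⁻ X X≢[]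
... | r , φ*X⁻𝟎 = r , (begin
  φ* (X ++ X ++ X ++ X ⁻) ++ 𝟎 ∷ []          ≡⟨ cong (_++ 𝟎 ∷ []) φ*-4⁻ ⟩
  (Y ++ Y ++ Y ++ φ* (X ⁻)) ++ 𝟎 ∷ []         ≡⟨ ++-assoc³ Y Y Y (φ* (X ⁻)) (𝟎 ∷ []) ⟩
  Y ++ Y ++ Y ++ (φ* (X ⁻) ++ 𝟎 ∷ [])        ≡⟨ cong (λ z → Y ++ Y ++ Y ++ z) φ*X⁻𝟎 ⟩
  Y ++ Y ++ Y ++ (Y ⁻ ++ r)                  ≡⟨ ++-assoc³ Y Y Y (Y ⁻) r ⟨
  (Y ++ Y ++ Y ++ Y ⁻) ++ r                  ∎)
  where
  open ≡-Reasoning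
  Y : Word
  Y = φ* X
  φ*-4⁻ : φ* (X ++ X ++ X ++ X ⁻) ≡ Y ++ Y ++ Y ++ φ* (X ⁻)
  φ*-4⁻ = trans (concatMap-++ φ X _) (cong (Y ++_)
          (trans (concatMap-++ φ X _) (cong (Y ++_) (concatMap-++ φ X (X ⁻)))))
  ++-assoc³ : ∀ (a b c d e : Word) → (a ++ b ++ c ++ d) ++ e ≡ a ++ b ++ c ++ (d ++ e)
  ++-assoc³ a b c d e =
    trans (++-assoc a _ e) (cong (a ++_) (trans (++-assoc b _ e) (cong (b ++_) (++-assoc c d e))))

OccursAt : ωWord → ℕ → Word → Set
OccursAt u i w = slice u i (length w) ≡ w

length-slice : ∀ u i n → length (slice u i n) ≡ n
length-slice u i zero = refl
length-slice u i (suc n) = cong suc (length-slice u (suc i) n)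

occursAt-slice : ∀ u i n → OccursAt u i (slice u i n)
occursAt-slice u i n = cong (slice u i) (length-slice u i n)

slice-+ : ∀ u i m n → slice u i (m + n) ≡ slice u i m ++ slice u (i + m) n
slice-+ u i zero n = cong (λ j → slice u j n) (sym (+-identityʳ i))
slice-+ u i (suc m) n = cong (u i ∷_)
  (trans (slice-+ u (suc i) m n) (cong (λ j → slice u (suc i) m ++ slice u j n) (sym (+-suc i m))))

occursAt-++ : ∀ u i (v w : Word) → OccursAt u i v → OccursAt u (i + length v) w → OccursAt u i (v ++ w)
occursAt-++ u i v w occ-v occ-w = begin
  slice u i (length (v ++ w))                        ≡⟨ cong (slice u i) (length-++ v) ⟩
  slice u i (length v + length w)                    ≡⟨ slice-+ u i (length v) (length w) ⟩
  slice u i (length v) ++ slice u (i + length v) (length w)  ≡⟨ cong₂ _++_ occ-v occ-w ⟩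
  v ++ w                                             ∎
  where open ≡-Reasoning

occursAt-++⁻ : ∀ u i (v w : Word) → OccursAt u i (v ++ w) → OccursAt u i v × OccursAt u (i + length v) w
occursAt-++⁻ u i [] w occ = refl , subst (λ j → OccursAt u j w) (sym (+-identityʳ i)) occ
occursAt-++⁻ u i (a ∷ v) w occ with ∷-injective occ
... | uᵢ≡a , occ′ with occursAt-++⁻ u (suc i) v w occ′
... | occ-v , occ-w = cong₂ _∷_ uᵢ≡a occ-v , subst (λ j → OccursAt u j w) (sym (+-suc i (length v))) occ-w

EarlyOccurrence : ωWord → Word → Parikh → Set
EarlyOccurrence u w p = ∃ λ i → OccursAt u i w × π (prefix i u) ≤π p

earlyOccurrence-++⁻ : ∀ {u p} (v r : Word) → EarlyOccurrence u (v ++ r) p → EarlyOccurrence u v p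
earlyOccurrence-++⁻ {u} v r (i , occ , bound) = i , proj₁ (occursAt-++⁻ u i v r occ) , bound

firstBlockStart : Letter → ℕ
firstBlockStart 𝟎 = 0
firstBlockStart 𝟏 = 1

complement : Letter → Letter
complement 𝟎 = 𝟏
complement 𝟏 = 𝟎

-- Without factor 11, u = s φ(u′₀) φ(u′₁) … with s ∈ {ε, 1}: each block starts with 0 and
-- is 01 or 0 according as the letter after that 0 is 1 or 0.
module Desubstitution (u : ωWord) (no-𝟏𝟏 : ¬ Factorω (𝟏 ∷ 𝟏 ∷ []) u) where

  𝟏-followedBy-𝟎 : ∀ i → u i ≡ 𝟏 → u (suc i) ≡ 𝟎
  𝟏-followedBy-𝟎 i uᵢ≡𝟏 with u (suc i) in e
  ... | 𝟎 = refl
  ... | 𝟏 = ⊥-elim (no-𝟏𝟏 (i , cong₂ (λ a b → a ∷ b ∷ []) uᵢ≡𝟏 e))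

  mutual
    decoded : ωWord
    decoded k = complement (u (suc (blockStart k)))

    blockStart : ℕ → ℕ
    blockStart zero = firstBlockStart (u 0)
    blockStart (suc k) = blockStart k + length (φ (decoded k))

  blockStart-𝟎 : ∀ k → u (blockStart k) ≡ 𝟎
  blockStart-𝟎 zero with u 0 in e
  ... | 𝟎 = e
  ... | 𝟏 = 𝟏-followedBy-𝟎 0 e
  blockStart-𝟎 (suc k) with u (suc (blockStart k)) in e
  ... | 𝟎 = subst (λ j → u j ≡ 𝟎) (+-comm 1 (blockStart k)) e
  ... | 𝟏 = subst (λ j → u j ≡ 𝟎) (+-comm 2 (blockStart k)) (𝟏-followedBy-𝟎 (suc (blockStart k)) e)

  occursAt-block : ∀ k → OccursAt u (blockStart k) (φ (decoded k))
  occursAt-block k with u (suc (blockStart k)) in e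
  ... | 𝟎 = cong (_∷ []) (blockStart-𝟎 k)
  ... | 𝟏 = cong₂ (λ a b → a ∷ b ∷ []) (blockStart-𝟎 k) e

  occursAt-φ* : ∀ k w → OccursAt decoded k w → OccursAt u (blockStart k) (φ* w ++ 𝟎 ∷ [])
  occursAt-φ* k [] _ = cong (_∷ []) (blockStart-𝟎 k)
  occursAt-φ* k (a ∷ w) occ with ∷-injective occ
  ... | refl , occ′ = subst (OccursAt u (blockStart k)) (sym (++-assoc (φ a) (φ* w) (𝟎 ∷ [])))
    (occursAt-++ u (blockStart k) (φ a) (φ* w ++ 𝟎 ∷ []) (occursAt-block k) (occursAt-φ* (suc k) w occ′))

  π-prefix-blockStart₀ : π (prefix (blockStart 0) u) ≤π ⟨ 0 , 1 ⟩
  π-prefix-blockStart₀ with u 0 in e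
  ... | 𝟎 = z≤n , z≤n
  ... | 𝟏 rewrite e = z≤n , s≤s z≤n

  earlyOccurrence-𝟎 : EarlyOccurrence u (𝟎 ∷ []) ⟨ 0 , 1 ⟩
  earlyOccurrence-𝟎 = blockStart 0 , cong (_∷ []) (blockStart-𝟎 0) , π-prefix-blockStart₀

  earlyOccurrence-φ* : ∀ {w p} → EarlyOccurrence decoded w p →
    EarlyOccurrence u (φ* w ++ 𝟎 ∷ []) (⟨ 0 , 1 ⟩ +π φπ p)
  earlyOccurrence-φ* {w} {p} (i , occ , bound) = start + length (φ* P) , proj₂ split , bound′
    where
    start : ℕ
    start = blockStart 0
    P : Word
    P = prefix i decoded
    occ-Pw : OccursAt decoded 0 (P ++ w)
    occ-Pw = occursAt-++ decoded 0 P w (occursAt-slice decoded 0 i)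
      (subst (λ j → OccursAt decoded j w) (sym (length-slice decoded 0 i)) occ)
    φ*-Pw𝟎 : φ* (P ++ w) ++ 𝟎 ∷ [] ≡ φ* P ++ (φ* w ++ 𝟎 ∷ [])
    φ*-Pw𝟎 = trans (cong (_++ 𝟎 ∷ []) (concatMap-++ φ P w)) (++-assoc (φ* P) (φ* w) _)
    split : OccursAt u start (φ* P) × OccursAt u (start + length (φ* P)) (φ* w ++ 𝟎 ∷ [])
    split = occursAt-++⁻ u start (φ* P) _ (subst (OccursAt u start) φ*-Pw𝟎 (occursAt-φ* 0 (P ++ w) occ-Pw))
    prefix-eq : prefix (start + length (φ* P)) u ≡ prefix start u ++ φ* P
    prefix-eq = trans (slice-+ u 0 start (length (φ* P))) (cong (prefix start u ++_) (proj₁ split))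
    bound′ : π (prefix (start + length (φ* P)) u) ≤π (⟨ 0 , 1 ⟩ +π φπ p)
    bound′ = subst (_≤π (⟨ 0 , 1 ⟩ +π φπ p)) (sym (begin
      π (prefix (start + length (φ* P)) u)  ≡⟨ cong π prefix-eq ⟩
      π (prefix start u ++ φ* P)            ≡⟨ π-++ (prefix start u) (φ* P) ⟩
      π (prefix start u) +π π (φ* P)        ≡⟨ cong (π (prefix start u) +π_) (π-φ* P) ⟩
      π (prefix start u) +π φπ (π P)        ∎))
      (+π-mono-≤π π-prefix-blockStart₀ (φπ-mono-≤π bound))
      where open ≡-Reasoning

  fauxBonacci-decoded : FauxBonacciω u → FauxBonacciω decoded
  fauxBonacci-decoded (_ , no-4⁻) = no-𝟏𝟏′ , no-4⁻′
    where
    no-𝟏𝟏′ : ¬ Factorω (𝟏 ∷ 𝟏 ∷ []) decoded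
    no-𝟏𝟏′ (k , occ) = no-4⁻ (𝟎 ∷ []) (λ ()) (blockStart k , occursAt-φ* k (𝟏 ∷ 𝟏 ∷ []) occ)
    no-4⁻′ : ∀ X → X ≢ [] → ¬ Factorω (4⁻-power X) decoded
    no-4⁻′ X X≢[] (k , occ) with φ*-4⁻-power X X≢[]
    ... | r , eq = no-4⁻ (φ* X) (φ*-≢[] X X≢[])
      (blockStart k , proj₁ (occursAt-++⁻ u (blockStart k) _ r
        (subst (OccursAt u (blockStart k)) eq (occursAt-φ* k (4⁻-power X) occ))))

fibBound : ℕ → Parikh
fibBound n = π (F n) -π π (𝟎 ∷ [])

fibBound-suc : ∀ n → ⟨ 0 , 1 ⟩ +π φπ (fibBound n) ≡ fibBound (suc n)
fibBound-suc n with F-head n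
... | t , Fn≡𝟎t = begin
  -- the second step holds by computation: the 0-count of 𝟎 ∷ t is positive, so the
  -- truncated subtractions are exact
  ⟨ 0 , 1 ⟩ +π φπ (fibBound n)   ≡⟨ cong (λ w → ⟨ 0 , 1 ⟩ +π φπ (π w -π π (𝟎 ∷ []))) Fn≡𝟎t ⟩
  φπ (π (𝟎 ∷ t)) -π π (𝟎 ∷ [])   ≡⟨ cong (λ w → φπ (π w) -π π (𝟎 ∷ [])) Fn≡𝟎t ⟨
  φπ (π (F n)) -π π (𝟎 ∷ [])     ≡⟨ cong (_-π π (𝟎 ∷ [])) (π-φ* (F n)) ⟨
  π (φ* (F n)) -π π (𝟎 ∷ [])     ≡⟨ cong (λ w → π w -π π (𝟎 ∷ [])) (φ*-F n) ⟩
  fibBound (suc n)               ∎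
  where open ≡-Reasoning

earlyOccurrence-F : ∀ k u → FauxBonacciω u → EarlyOccurrence u (F (2 + k)) (fibBound (2 + k))
earlyOccurrence-F zero u fb =
  earlyOccurrence-φ* (Desubstitution.earlyOccurrence-𝟎 decoded (proj₁ (fauxBonacci-decoded fb)))
  where open Desubstitution u (proj₁ fb)
earlyOccurrence-F (suc k) u fb =
  subst₂ (EarlyOccurrence u) (φ*-F (2 + k)) (fibBound-suc (2 + k))
    (earlyOccurrence-++⁻ (φ* (F (2 + k))) (𝟎 ∷ [])
      (earlyOccurrence-φ* (earlyOccurrence-F k decoded (fauxBonacci-decoded fb))))
  where open Desubstitution u (proj₁ fb)

shortestPrefix-length-≤ : ∀ {u y v i} → ShortestPrefixEndingIn u y v → OccursAt u i v → length y ≤ i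
shortestPrefix-length-≤ {u} {y} {v} {i} (_ , shortest) occ with length y ≤? i
... | yes |y|≤i = |y|≤i
... | no |y|≰i = ⊥-elim (shortest (i + length v) earlier (prefix i u , ends))
  where
  earlier : i + length v < length (y ++ v)
  earlier rewrite length-++ y {v} = +-monoˡ-< (length v) (≰⇒> |y|≰i)
  ends : prefix (i + length v) u ≡ prefix i u ++ v
  ends = trans (slice-+ u 0 i (length v)) (cong (prefix i u ++_) occ)

π-prefix-≤π : ∀ u y i → OccursAt u 0 y → length y ≤ i → π y ≤π π (prefix i u)
π-prefix-≤π u y i occ |y|≤i =
  subst (π y ≤π_) (sym (trans (cong π prefix-eq) (π-++ y rest))) (≤π-+π (π y) (π rest))
  where
  open ≡-Reasoning
  rest : Word
  rest = slice u (length y) (i ∸ length y)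
  prefix-eq : prefix i u ≡ y ++ rest
  prefix-eq = begin
    slice u 0 i                              ≡⟨ cong (slice u 0) (m+[n∸m]≡n |y|≤i) ⟨
    slice u 0 (length y + (i ∸ length y))    ≡⟨ slice-+ u 0 (length y) (i ∸ length y) ⟩
    prefix (length y) u ++ rest              ≡⟨ cong (_++ rest) occ ⟩
    y ++ rest                                ∎

lemma6 : (u : ωWord) → FauxBonacciω u → (n : ℕ) → 2 ≤ n → (y : Word) →
    ShortestPrefixEndingIn u y (F n) →
    π y ≤π (π (F n) -π π (𝟎 ∷ []))
lemma6 u fb (suc (suc k)) (s≤s (s≤s z≤n)) y shortest with earlyOccurrence-F k u fb
... | i , occ , early = ≤π-trans (π-prefix-≤π u y i occ-y (shortestPrefix-length-≤ {y = y} shortest occ)) early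
  where
  occ-y : OccursAt u 0 y
  occ-y = proj₁ (occursAt-++⁻ u 0 y (F (2 + k)) (proj₁ shortest))
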